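{- If $l$ and $n$ are ample positive integers, then $l n$ is ample.
   Context: For positive integers, write $m \lfloor n$ to mean that $m$ is a proper divisor of $n$ (i.e. $m \mid n$ and $m < n$). The number of recursive divisors is defined by $a(1)=1$ and $a(n) = 1 + \sum_{m \lfloor n} a(m)$ for $n>1$. A positive integer $n$ is called ample if $a(n) > n$. -}

module Defs where

open import Data.Nat using (ℕ; zero; suc; _+_; _<_; _>_)
open import Data.Nat.Divisibility using (_∣?_)
open import Data.List using (List; map; filter; upTo; drop)
open import Data.Nat.ListAction using (sum)
open import Relation.Nullary.Decidable using (Dec)

properDivisors : ℕ → List ℕ
properDivisors n = filter (λ m → m ∣? n) (drop 1 (upTo n))

-- Fuel-indexed recursion: aF k n computes a(n) whenever k ≥ n
-- (all proper divisors m of n satisfy m < n, so fuel k-1 suffices for them).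
aF : ℕ → ℕ → ℕ
aF zero    n = 1
aF (suc k) n = 1 + sum (map (aF k) (properDivisors n))

-- Number of recursive divisors: a(1) = 1, a(n) = 1 + Σ_{m ⌊ n} a(m).
a : ℕ → ℕ
a n = aF n n

Ample : ℕ → Set
Ample n = a n > n

{-# OPTIONS --safe #-}
-- a is supermultiplicative, a l * a n ≤ a (l n).  Expanding
-- a l = 1 + Σ_{d ⌊ l} a d gives a l * a n = a n + Σ_{d ⌊ l} a d * a n, and by
-- induction a d * a n ≤ a (d n).  On the other side the proper divisors e of n
-- and the numbers d n with d ⌊ l are distinct proper divisors of l n, so
-- a (l n) ≥ (1 + Σ_{e ⌊ n} a e) + Σ_{d ⌊ l} a (d n) = a n + Σ_{d ⌊ l} a (d n).
-- Hence l n < a l * a n ≤ a (l n) when l and n are ample.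
module Submission where

open import Defs
open import Data.Nat using (ℕ; zero; suc; _+_; _*_; _≤_; _<_; _>_; z≤n; s≤s)
open import Data.Nat.Properties
open import Data.Nat.Divisibility using (_∣?_; ∣n⇒∣m*n; *-monoˡ-∣)
open import Data.Nat.Induction using (<-rec)
open import Data.List using (map; filter; applyUpTo)
open import Data.Nat.ListAction using (sum)
open import Relation.Nullary using (Dec; yes; no)
open import Relation.Unary using (Pred; Decidable)
open import Relation.Binary.PropositionalEquality
open import Data.Empty using (⊥-elim)

sumBelow : (ℕ → ℕ) → ℕ → ℕ
sumBelow h zero    = 0
sumBelow h (suc k) = h 0 + sumBelow (λ i → h (suc i)) k

sumBelow-cong : ∀ {h h′} k → (∀ i → i < k → h i ≡ h′ i) → sumBelow h k ≡ sumBelow h′ k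
sumBelow-cong zero    e = refl
sumBelow-cong (suc k) e = cong₂ _+_ (e 0 (s≤s z≤n)) (sumBelow-cong k (λ i p → e (suc i) (s≤s p)))

sumBelow-mono-≤ : ∀ {h h′} k → (∀ i → i < k → h i ≤ h′ i) → sumBelow h k ≤ sumBelow h′ k
sumBelow-mono-≤ zero    e = z≤n
sumBelow-mono-≤ (suc k) e = +-mono-≤ (e 0 (s≤s z≤n)) (sumBelow-mono-≤ k (λ i p → e (suc i) (s≤s p)))

sumBelow-+ : ∀ h j k → sumBelow h (j + k) ≡ sumBelow h j + sumBelow (λ i → h (j + i)) k
sumBelow-+ h zero    k = refl
sumBelow-+ h (suc j) k = begin
  h 0 + sumBelow (λ i → h (suc i)) (j + k)
    ≡⟨ cong (h 0 +_) (sumBelow-+ (λ i → h (suc i)) j k) ⟩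
  h 0 + (sumBelow (λ i → h (suc i)) j + sumBelow (λ i → h (suc j + i)) k)
    ≡⟨ +-assoc (h 0) _ _ ⟨
  sumBelow h (suc j) + sumBelow (λ i → h (suc j + i)) k ∎
  where open ≡-Reasoning

sumBelow-*-distribʳ : ∀ h x k → sumBelow h k * x ≡ sumBelow (λ i → h i * x) k
sumBelow-*-distribʳ h x zero    = refl
sumBelow-*-distribʳ h x (suc k) =
  trans (*-distribʳ-+ x (h 0) _) (cong (h 0 * x +_) (sumBelow-*-distribʳ (λ i → h (suc i)) x k))

sumBelow-stride-≤ : ∀ g s k → sumBelow (λ d → g (d * suc s)) k ≤ sumBelow g (k * suc s)
sumBelow-stride-≤ g s zero    = z≤n
sumBelow-stride-≤ g s (suc k) = begin
  g 0 + sumBelow (λ d → g (suc s + d * suc s)) k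
    ≤⟨ +-mono-≤ (m≤m+n (g 0) _) (sumBelow-stride-≤ (λ i → g (suc s + i)) s k) ⟩
  sumBelow g (suc s) + sumBelow (λ i → g (suc s + i)) (k * suc s)
    ≡⟨ sumBelow-+ g (suc s) (k * suc s) ⟨
  sumBelow g (suc k * suc s) ∎
  where open ≤-Reasoning

when : {A : Set} → Dec A → ℕ → ℕ
when (yes _) x = x
when (no _)  _ = 0

when-mono-≤ : {A B : Set} (a? : Dec A) (b? : Dec B) {x y : ℕ} →
              (A → B) → (A → x ≤ y) → when a? x ≤ when b? y
when-mono-≤ (yes a) (yes _) _   x≤y = x≤y a
when-mono-≤ (yes a) (no ¬b) a⇒b _   = ⊥-elim (¬b (a⇒b a))
when-mono-≤ (no _)  _       _   _   = z≤n

when-*ˡ : {A : Set} (a? : Dec A) (x y : ℕ) → when a? x * y ≡ when a? (x * y)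
when-*ˡ (yes _) x y = refl
when-*ˡ (no _)  x y = refl

sum-map-filter-applyUpTo : ∀ {P : Pred ℕ _} (P? : Decidable P) f g k →
  sum (map f (filter P? (applyUpTo g k))) ≡ sumBelow (λ i → when (P? (g i)) (f (g i))) k
sum-map-filter-applyUpTo P? f g zero = refl
sum-map-filter-applyUpTo P? f g (suc k) with P? (g 0)
... | yes _ = cong (f (g 0) +_) (sum-map-filter-applyUpTo P? f (λ i → g (suc i)) k)
... | no _  = sum-map-filter-applyUpTo P? f (λ i → g (suc i)) k

aF-zero : ∀ k → aF k 0 ≡ 1
aF-zero zero    = refl
aF-zero (suc k) = refl

aF-suc : ∀ k M → aF (suc k) (suc M) ≡ suc (sumBelow (λ i → when (suc i ∣? suc M) (aF k (suc i))) M)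
aF-suc k M = cong suc (sum-map-filter-applyUpTo (_∣? suc M) (aF k) suc M)

aF-fuel-irrelevant : ∀ k k′ n → n ≤ k → n ≤ k′ → aF k n ≡ aF k′ n
aF-fuel-irrelevant k k′ zero _ _ = trans (aF-zero k) (sym (aF-zero k′))
aF-fuel-irrelevant (suc k) (suc k′) (suc M) (s≤s M≤k) (s≤s M≤k′) = begin
  aF (suc k) (suc M)
    ≡⟨ aF-suc k M ⟩
  suc (sumBelow (λ i → when (suc i ∣? suc M) (aF k (suc i))) M)
    ≡⟨ cong suc (sumBelow-cong M λ i i<M → cong (when (suc i ∣? suc M))
         (aF-fuel-irrelevant k k′ (suc i) (≤-trans i<M M≤k) (≤-trans i<M M≤k′))) ⟩
  suc (sumBelow (λ i → when (suc i ∣? suc M) (aF k′ (suc i))) M)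
    ≡⟨ aF-suc k′ M ⟨
  aF (suc k′) (suc M) ∎
  where open ≡-Reasoning

aIfDivides : ℕ → ℕ → ℕ
aIfDivides n m = when (m ∣? n) (a m)

a-suc : ∀ M → a (suc M) ≡ suc (sumBelow (λ i → aIfDivides (suc M) (suc i)) M)
a-suc M = trans (aF-suc M M) (cong suc (sumBelow-cong M λ i i<M →
  cong (when (suc i ∣? suc M)) (aF-fuel-irrelevant M (suc i) (suc i) i<M ≤-refl)))

-- The divisors of n occupy the first N′ terms of the sum for a (l n); the
-- multiple suc d * n is term N′ + d * n, because suc d * suc N′ reduces to
-- suc (N′ + d * suc N′), so the stride lemma picks exactly these.
a-*-lower-bound : ∀ L N′ → let n = suc N′ in
  a n + sumBelow (λ d → when (suc d ∣? suc L) (a (suc d * n))) L ≤ a (suc L * n)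
a-*-lower-bound L N′ = begin
  a n + multiples
    ≡⟨ cong (_+ multiples) (a-suc N′) ⟩
  suc (sumBelow (λ i → aIfDivides n (suc i)) N′ + multiples)
    ≤⟨ s≤s (+-mono-≤ divisors-of-n multiples-of-n) ⟩
  suc (sumBelow H N′ + sumBelow (λ i → H (N′ + i)) (L * n))
    ≡⟨ cong suc (sumBelow-+ H N′ (L * n)) ⟨
  suc (sumBelow H (N′ + L * n))
    ≡⟨ a-suc (N′ + L * n) ⟨
  a (suc L * n) ∎
  where
  open ≤-Reasoning
  n = suc N′
  H = λ i → aIfDivides (suc L * n) (suc i)
  multiples = sumBelow (λ d → when (suc d ∣? suc L) (a (suc d * n))) L
  divisors-of-n : sumBelow (λ i → aIfDivides n (suc i)) N′ ≤ sumBelow H N′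
  divisors-of-n = sumBelow-mono-≤ N′ λ i _ →
    when-mono-≤ (suc i ∣? n) (suc i ∣? suc L * n) (∣n⇒∣m*n (suc L)) (λ _ → ≤-refl)
  multiples-of-n : multiples ≤ sumBelow (λ i → H (N′ + i)) (L * n)
  multiples-of-n = ≤-trans
    (sumBelow-mono-≤ L λ d _ →
      when-mono-≤ (suc d ∣? suc L) (suc d * n ∣? suc L * n) (*-monoˡ-∣ n) (λ _ → ≤-refl))
    (sumBelow-stride-≤ (λ i → H (N′ + i)) N′ L)

a-*-expand : ∀ L n → a (suc L) * a n ≡ a n + sumBelow (λ d → when (suc d ∣? suc L) (a (suc d) * a n)) L
a-*-expand L n = begin
  a (suc L) * a n
    ≡⟨ cong (_* a n) (a-suc L) ⟩
  a n + sumBelow (λ d → aIfDivides (suc L) (suc d)) L * a n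
    ≡⟨ cong (a n +_) (sumBelow-*-distribʳ _ (a n) L) ⟩
  a n + sumBelow (λ d → aIfDivides (suc L) (suc d) * a n) L
    ≡⟨ cong (a n +_) (sumBelow-cong L λ d _ → when-*ˡ (suc d ∣? suc L) (a (suc d)) (a n)) ⟩
  a n + sumBelow (λ d → when (suc d ∣? suc L) (a (suc d) * a n)) L ∎
  where open ≡-Reasoning

a-supermultiplicative : ∀ L N′ → a (suc L) * a (suc N′) ≤ a (suc L * suc N′)
a-supermultiplicative L N′ = <-rec P step L
  where
  n = suc N′
  P = λ L → a (suc L) * a n ≤ a (suc L * n)
  step : ∀ L → (∀ {d} → d < L → P d) → P L
  step L ih = begin
    a (suc L) * a n
      ≡⟨ a-*-expand L n ⟩
    a n + sumBelow (λ d → when (suc d ∣? suc L) (a (suc d) * a n)) L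
      ≤⟨ +-monoʳ-≤ (a n) (sumBelow-mono-≤ L λ d d<L →
           when-mono-≤ (suc d ∣? suc L) (suc d ∣? suc L) (λ d∣l → d∣l) (λ _ → ih d<L)) ⟩
    a n + sumBelow (λ d → when (suc d ∣? suc L) (a (suc d * n))) L
      ≤⟨ a-*-lower-bound L N′ ⟩
    a (suc L * n) ∎
    where open ≤-Reasoning

corollary1 : (l n : ℕ) → l > 0 → n > 0 → Ample l → Ample n → Ample (l * n)
corollary1 (suc L) (suc N′) _ _ l<al n<an = begin-strict
  suc L * suc N′          <⟨ *-mono-< l<al n<an ⟩
  a (suc L) * a (suc N′)  ≤⟨ a-supermultiplicative L N′ ⟩
  a (suc L * suc N′)      ∎
  where open ≤-Reasoning
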